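{- In a simple tangle solving a $321$-avoiding permutation, no path has both an L-segment and an R-segment.
   Context: $S_n$ is the set of permutations of $\{1,\dots,n\}$, $\pi(p)$ the element at position $p$. The swap $\sigma(i)$ exchanges the elements at positions $i,i+1$. Two permutations are adjacent if one is obtained from the other by swaps $\sigma(p_1),\dots,\sigma(p_k)$ ($k\ge0$) with pairwise $|p_i-p_j|\ge2$. A tangle is a finite sequence $\pi_0,\dots,\pi_m$ with consecutive permutations adjacent; it solves $\pi$ if $\pi_0=\pi$ and $\pi_m$ is the identity (by convention $\pi_0=\pi_1$, $\pi_{m-1}=\pi_m$). In the drawing, element $x$ at time $t$ is at $(p,-t)$ where $\pi_t(p)=x$, and path $x$ is the polyline through these points. A segment is a maximal straight piece of a path; a non-vertical segment is an L-segment if, traversed downward, it moves left, and an R-segment if it moves right. A tangle solving $\pi$ is simple if it has the minimum number of path crossings among all tangles solving $\pi$ (equivalently no two paths cross more than once). $\pi$ is $321$-avoiding if there are no positions $p<q<r$ with $\pi(p)>\pi(q)>\pi(r)$. -}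

module Defs where

open import Data.Nat as ℕ using (ℕ; zero; suc; _≤_; _<_; _∸_; ∣_-_∣)
open import Data.Integer as ℤ using (ℤ; +_; -[1+_])
open import Data.Fin as Fin using (Fin; toℕ)
open import Data.Fin.Permutation using (Permutation′; _⟨$⟩ʳ_; _⟨$⟩ˡ_)
open import Data.Fin.Permutation.Components using (transpose)
open import Data.List using (List; []; _∷_; length; filter; map; upTo; allFin; cartesianProduct)
open import Data.List.Relation.Unary.AllPairs using (AllPairs)
open import Data.Nat.ListAction using (sum)
open import Data.Product using (Σ; _×_; _,_; proj₁; proj₂)
open import Data.Sum using (_⊎_)
open import Relation.Nullary using (¬_)
open import Relation.Nullary.Decidable using (_×-dec_)
open import Relation.Binary.PropositionalEquality using (_≡_; _≢_)

-- Elements {1,…,n} and positions {1,…,n} are represented by Fin n (shifted by one).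
-- A permutation π ∈ S_n: π ⟨$⟩ʳ p is the element at position p,
-- π ⟨$⟩ˡ x is the position of element x.
Perm : ℕ → Set
Perm n = Permutation′ n

_≐_ : ∀ {n} → Perm n → Perm n → Set
π ≐ ρ = ∀ p → π ⟨$⟩ʳ p ≡ ρ ⟨$⟩ʳ p

record Swap (n : ℕ) : Set where
  field
    pos  : Fin n
    next : Fin n
    isNext : toℕ next ≡ suc (toℕ pos)
open Swap public

-- the position map of a sequence of swaps σ(p₁),…,σ(p_k) applied in order:
-- after the swaps, the element at position q is the old element at position
-- τ₁(τ₂(… τ_k(q))) where τᵢ transposes pᵢ and pᵢ+1.
applySwaps : ∀ {n} → List (Swap n) → Fin n → Fin n
applySwaps [] q = q
applySwaps (s ∷ ss) q = transpose (pos s) (next s) (applySwaps ss q)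

ObtainedBySwaps : ∀ {n} → Perm n → Perm n → Set
ObtainedBySwaps {n} π ρ =
  Σ (List (Swap n)) λ ss →
    AllPairs (λ s s′ → 2 ≤ ∣ toℕ (pos s) - toℕ (pos s′) ∣) ss
    × (∀ q → ρ ⟨$⟩ʳ q ≡ π ⟨$⟩ʳ applySwaps ss q)

Adjacent : ∀ {n} → Perm n → Perm n → Set
Adjacent π ρ = ObtainedBySwaps π ρ ⊎ ObtainedBySwaps ρ π

-- A tangle π₀,…,π_m (values of `perm` at times > m are irrelevant).
record Tangle (n : ℕ) : Set where
  field
    len  : ℕ
    perm : ℕ → Perm n
    adjacent : ∀ t → t < len → Adjacent (perm t) (perm (suc t))
open Tangle public

idPerm : ∀ {n} → Perm n → Set
idPerm π = ∀ p → π ⟨$⟩ʳ p ≡ p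

Solves : ∀ {n} → Tangle n → Perm n → Set
Solves T π =
  (perm T 0 ≐ π) × idPerm (perm T (len T))
  × (1 ≤ len T) × (perm T 0 ≐ perm T 1)
  × (perm T (len T ∸ 1) ≐ perm T (len T))

-- Crossings: between times t and t+1 two paths cross exactly when the elements at
-- some positions p, p+1 are exchanged.  crossingsAt T t counts such pairs of positions.
crossingsAt : ∀ {n} → Tangle n → ℕ → ℕ
crossingsAt {n} T t =
  length (filter
    (λ pq → (toℕ (proj₂ pq) ℕ.≟ suc (toℕ (proj₁ pq)))
       ×-dec (perm T t ⟨$⟩ʳ proj₁ pq Fin.≟ perm T (suc t) ⟨$⟩ʳ proj₂ pq)
       ×-dec (perm T t ⟨$⟩ʳ proj₂ pq Fin.≟ perm T (suc t) ⟨$⟩ʳ proj₁ pq))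
    (cartesianProduct (allFin n) (allFin n)))

crossings : ∀ {n} → Tangle n → ℕ
crossings T = sum (map (crossingsAt T) (upTo (len T)))

SimpleSolving : ∀ {n} → Tangle n → Perm n → Set
SimpleSolving {n} T π =
  Solves T π × (∀ (T′ : Tangle n) → Solves T′ π → crossings T ≤ crossings T′)

Avoids321 : ∀ {n} → Perm n → Set
Avoids321 π = ∀ p q r → p Fin.< q → q Fin.< r →
  ¬ ((π ⟨$⟩ʳ q) Fin.< (π ⟨$⟩ʳ p) × (π ⟨$⟩ʳ r) Fin.< (π ⟨$⟩ʳ q))

-- position of element x at time t (path x passes through (position x t , -t))
position : ∀ {n} → Tangle n → Fin n → ℕ → ℕ
position T x t = toℕ (perm T t ⟨$⟩ˡ x)

step : ∀ {n} → Tangle n → Fin n → ℕ → ℤ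
step T x t = + position T x (suc t) ℤ.- + position T x t

-- A segment of path x: a maximal time interval [a,b] (a < b ≤ m) on which all
-- pieces have the same direction, i.e. a maximal straight piece of the polyline.
IsSegment : ∀ {n} → Tangle n → Fin n → ℕ → ℕ → Set
IsSegment T x a b =
  a < b × b ≤ len T
  × (∀ t → a ≤ t → t < b → step T x t ≡ step T x a)
  × (a ≡ 0 ⊎ Σ ℕ (λ a′ → (a ≡ suc a′) × (step T x a′ ≢ step T x a)))
  × (b ≡ len T ⊎ step T x b ≢ step T x a)

HasLSegment : ∀ {n} → Tangle n → Fin n → Set
HasLSegment T x = Σ ℕ λ a → Σ ℕ λ b → IsSegment T x a b × (step T x a ℤ.< + 0)

HasRSegment : ∀ {n} → Tangle n → Fin n → Set
HasRSegment T x = Σ ℕ λ a → Σ ℕ λ b → IsSegment T x a b × (+ 0 ℤ.< step T x a)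

-- In a simple tangle two paths meet at most once: if u and v met at times t₁ < t₂, exchanging the
-- labels u and v at all times in (t₁, t₂] would give a tangle solving π with fewer crossings. Since
-- a single swap moves every element by at most one position, the relative order of two paths
-- changes exactly when they meet, so a pair meeting once has opposite orders in π and in the
-- identity: the path on the left before the meeting carries the larger element. If path x has an
-- L-segment, x overtakes some y, so y > x stands left of x in π; an R-segment likewise yields some
-- z < x standing right of x. Then y, x, z is a 321 pattern in π.
module Submission where

open import Defs
open import Data.Nat using (ℕ; zero; suc; _≤_; _<_; _∸_; ∣_-_∣; z≤n; s≤s; _<?_; _≤?_; _≤′_; ≤′-refl; ≤′-step)
import Data.Nat.Properties as NP
open import Data.Fin as Fin using (Fin; toℕ)
import Data.Fin.Properties as FP
open import Data.Fin.Permutation using (_⟨$⟩ʳ_; _⟨$⟩ˡ_; inverseʳ; _∘ₚ_)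
import Data.Fin.Permutation as PF
open import Data.Fin.Permutation.Components using (transpose)
open import Data.Integer as ℤ using (ℤ; +_)
import Data.Integer.Properties as ZP
open import Data.List using (List; []; _∷_; _++_; filter; length; map; allFin; cartesianProduct)
open import Data.List.Relation.Unary.All as All using (All; []; _∷_)
import Data.List.Relation.Unary.All.Properties as AllP
open import Data.List.Relation.Unary.AllPairs using (AllPairs; []; _∷_)
open import Data.List.Relation.Unary.Any using (here; there)
open import Data.List.Membership.Propositional using (_∈_)
open import Data.List.Membership.Propositional.Properties using (∈-upTo⁺; ∈-cartesianProduct⁺; ∈-allFin)
open import Data.Nat.ListAction using (sum)
open import Data.Product using (Σ; _×_; _,_; proj₁; proj₂)
open import Data.Sum using (_⊎_; inj₁; inj₂)
open import Function using (_∘_; id; flip)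
open import Function.Bundles using (module Inverse; module Injection)
open import Function.Properties.Inverse using (Inverse⇒Injection)
open import Data.Empty using (⊥)
open import Relation.Nullary using (¬_; Dec; yes; no; contradiction)
open import Relation.Nullary.Decidable using (_×-dec_)
open import Relation.Unary using (Decidable)
open import Relation.Binary.Definitions using (tri<; tri≈; tri>)
open import Relation.Binary.PropositionalEquality

private
  variable
    n : ℕ

⟨$⟩ʳ-injective : (π : Perm n) {p q : Fin n} → π ⟨$⟩ʳ p ≡ π ⟨$⟩ʳ q → p ≡ q
⟨$⟩ʳ-injective π = Injection.injective (Inverse⇒Injection π)

⟨$⟩ˡ-from-⟨$⟩ʳ : (π : Perm n) {p x : Fin n} → π ⟨$⟩ʳ p ≡ x → π ⟨$⟩ˡ x ≡ p
⟨$⟩ˡ-from-⟨$⟩ʳ π = Inverse.inverseʳ π ∘ sym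

record Exchanges (τ : Fin n → Fin n) (a b : Fin n) : Set where
  field
    image-a : τ a ≡ b
    image-b : τ b ≡ a
    fixes   : ∀ w → w ≢ a → w ≢ b → τ w ≡ w
open Exchanges

module _ {τ : Fin n → Fin n} {a b : Fin n} (ex : Exchanges τ a b) where

  exchanges-cases : ∀ w → (w ≡ a × τ w ≡ b) ⊎ (w ≡ b × τ w ≡ a) ⊎ (w ≢ a × w ≢ b × τ w ≡ w)
  exchanges-cases w with w FP.≟ a | w FP.≟ b
  ... | yes refl | _        = inj₁ (refl , image-a ex)
  ... | no _     | yes refl = inj₂ (inj₁ (refl , image-b ex))
  ... | no w≢a   | no w≢b   = inj₂ (inj₂ (w≢a , w≢b , fixes ex w w≢a w≢b))

  exchanges-sym : Exchanges τ b a
  exchanges-sym = record { image-a = image-b ex ; image-b = image-a ex ; fixes = λ w w≢b w≢a → fixes ex w w≢a w≢b }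

  exchanges-involutive : ∀ w → τ (τ w) ≡ w
  exchanges-involutive w with exchanges-cases w
  ... | inj₁ (refl , τw≡b)             = trans (cong τ τw≡b) (image-b ex)
  ... | inj₂ (inj₁ (refl , τw≡a))      = trans (cong τ τw≡a) (image-a ex)
  ... | inj₂ (inj₂ (_ , _ , τw≡w))     = trans (cong τ τw≡w) τw≡w

  exchanges-injective : ∀ {w w′} → τ w ≡ τ w′ → w ≡ w′
  exchanges-injective {w} {w′} e =
    trans (sym (exchanges-involutive w)) (trans (cong τ e) (exchanges-involutive w′))

transpose-exchanges : (a b : Fin n) → Exchanges (transpose a b) a b
transpose-exchanges a b = record { image-a = image-a′ ; image-b = image-b′ ; fixes = fixes′ }
  where
  image-a′ : transpose a b a ≡ b
  image-a′ with a FP.≟ a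
  ... | yes _   = refl
  ... | no a≢a  = contradiction refl a≢a
  image-b′ : transpose a b b ≡ a
  image-b′ with b FP.≟ a
  ... | yes b≡a = b≡a
  ... | no _ with b FP.≟ b
  ...   | yes _  = refl
  ...   | no b≢b = contradiction refl b≢b
  fixes′ : ∀ w → w ≢ a → w ≢ b → transpose a b w ≡ w
  fixes′ w w≢a w≢b with w FP.≟ a
  ... | yes w≡a = contradiction w≡a w≢a
  ... | no _ with w FP.≟ b
  ...   | yes w≡b = contradiction w≡b w≢b
  ...   | no _    = refl

exchanges-comm : ∀ {τ σ : Fin n → Fin n} {a a′ b b′} → Exchanges τ a a′ → Exchanges σ b b′ →
                 a ≢ b → a ≢ b′ → a′ ≢ b → a′ ≢ b′ → ∀ k → τ (σ k) ≡ σ (τ k)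
exchanges-comm {τ = τ} {σ} {a} {a′} {b} {b′} exτ exσ a≢b a≢b′ a′≢b a′≢b′ k
  with exchanges-cases exσ k | exchanges-cases exτ k
... | inj₁ (refl , _)           | inj₁ (refl , _)           = contradiction refl a≢b
... | inj₁ (refl , _)           | inj₂ (inj₁ (refl , _))    = contradiction refl a′≢b
... | inj₁ (refl , σk)          | inj₂ (inj₂ (_ , _ , τk))
  rewrite σk | τk = trans (fixes exτ b′ (a≢b′ ∘ sym) (a′≢b′ ∘ sym)) (sym (image-a exσ))
... | inj₂ (inj₁ (refl , _))    | inj₁ (refl , _)           = contradiction refl a≢b′
... | inj₂ (inj₁ (refl , _))    | inj₂ (inj₁ (refl , _))    = contradiction refl a′≢b′
... | inj₂ (inj₁ (refl , σk))   | inj₂ (inj₂ (_ , _ , τk))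
  rewrite σk | τk = trans (fixes exτ b (a≢b ∘ sym) (a′≢b ∘ sym)) (sym (image-b exσ))
... | inj₂ (inj₂ (_ , _ , σk))  | inj₁ (refl , τk)
  rewrite σk | τk = sym (fixes exσ a′ a′≢b a′≢b′)
... | inj₂ (inj₂ (_ , _ , σk))  | inj₂ (inj₁ (refl , τk))
  rewrite σk | τk = sym (fixes exσ a a≢b a≢b′)
... | inj₂ (inj₂ (_ , _ , σk))  | inj₂ (inj₂ (_ , _ , τk))
  rewrite σk | τk = sym σk

Apart : Swap n → Swap n → Set
Apart s s′ = 2 ≤ ∣ toℕ (pos s) - toℕ (pos s′) ∣

Untouched : Fin n → Swap n → Set
Untouched c s = c ≢ pos s × c ≢ next s

swapping : Swap n → Fin n → Fin n
swapping s = transpose (pos s) (next s)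

swapping-exchanges : (s : Swap n) → Exchanges (swapping s) (pos s) (next s)
swapping-exchanges s = transpose-exchanges (pos s) (next s)

∣n-1+n∣≡1 : ∀ m → ∣ m - suc m ∣ ≡ 1
∣n-1+n∣≡1 zero    = refl
∣n-1+n∣≡1 (suc m) = ∣n-1+n∣≡1 m

∣1+n-n∣≡1 : ∀ m → ∣ suc m - m ∣ ≡ 1
∣1+n-n∣≡1 m = trans (NP.∣-∣-comm (suc m) m) (∣n-1+n∣≡1 m)

∣-∣≤1 : ∀ {m m′} → m ≡ m′ ⊎ m′ ≡ suc m ⊎ m ≡ suc m′ → ∣ m - m′ ∣ ≤ 1
∣-∣≤1 {m} (inj₁ refl)        = NP.≤-trans (NP.≤-reflexive (NP.∣n-n∣≡0 m)) z≤n
∣-∣≤1 {m} (inj₂ (inj₁ refl)) = NP.≤-reflexive (∣n-1+n∣≡1 m)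
∣-∣≤1 {m′ = m′} (inj₂ (inj₂ refl)) = NP.≤-reflexive (∣1+n-n∣≡1 m′)

module _ (s s′ : Swap n) (apart : Apart s s′) where

  private
    clash : let p = toℕ (pos s) ; p′ = toℕ (pos s′) in p ≡ p′ ⊎ p′ ≡ suc p ⊎ p ≡ suc p′ → ⊥
    clash close = NP.≤⇒≯ (∣-∣≤1 close) apart

  apart⇒pos-untouched : Untouched (pos s) s′
  apart⇒pos-untouched =
      (λ e → clash (inj₁ (cong toℕ e)))
    , (λ e → clash (inj₂ (inj₂ (trans (cong toℕ e) (isNext s′)))))

  apart⇒next-untouched : Untouched (next s) s′
  apart⇒next-untouched =
      (λ e → clash (inj₂ (inj₁ (trans (cong toℕ (sym e)) (isNext s)))))
    , (λ e → clash (inj₁ (NP.suc-injective (trans (sym (isNext s)) (trans (cong toℕ e) (isNext s′))))))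

applySwaps-untouched⁻¹ : ∀ (ss : List (Swap n)) {c} → All (Untouched c) ss → ∀ q → applySwaps ss q ≡ c → q ≡ c
applySwaps-untouched⁻¹ []       _                      q e = e
applySwaps-untouched⁻¹ (s ∷ ss) ((c≢pos , c≢next) ∷ u) q e
  with exchanges-cases (swapping-exchanges s) (applySwaps ss q)
... | inj₁ (_ , tq)               = contradiction (trans (sym e) tq) c≢next
... | inj₂ (inj₁ (_ , tq))        = contradiction (trans (sym e) tq) c≢pos
... | inj₂ (inj₂ (_ , _ , tq))    = applySwaps-untouched⁻¹ ss u q (trans (sym tq) e)

record IsLocalInvolution (A : Fin n → Fin n) : Set where
  field
    involutive : ∀ q → A (A q) ≡ q
    moves≤1ʳ   : ∀ q → toℕ (A q) ≤ suc (toℕ q)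
    moves≤1ˡ   : ∀ q → toℕ q ≤ suc (toℕ (A q))
open IsLocalInvolution

applySwaps-isLocalInvolution : ∀ (ss : List (Swap n)) → AllPairs Apart ss → IsLocalInvolution (applySwaps ss)
applySwaps-isLocalInvolution []       _ = record
  { involutive = λ _ → refl ; moves≤1ʳ = λ _ → NP.n≤1+n _ ; moves≤1ˡ = λ _ → NP.n≤1+n _ }
applySwaps-isLocalInvolution (s ∷ ss) (apart ∷ apartss) = record
  { involutive = involutive′ ; moves≤1ʳ = proj₁ ∘ moves≤1 ; moves≤1ˡ = proj₂ ∘ moves≤1 }
  where
  A  = applySwaps ss
  IH = applySwaps-isLocalInvolution ss apartss
  ex = swapping-exchanges s
  τ  = swapping s

  pos-untouched : All (Untouched (pos s)) ss
  pos-untouched = All.map (λ {s′} → apart⇒pos-untouched s s′) apart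
  next-untouched : All (Untouched (next s)) ss
  next-untouched = All.map (λ {s′} → apart⇒next-untouched s s′) apart

  A-fixes-pos : A (pos s) ≡ pos s
  A-fixes-pos = applySwaps-untouched⁻¹ ss pos-untouched _ (involutive IH (pos s))
  A-fixes-next : A (next s) ≡ next s
  A-fixes-next = applySwaps-untouched⁻¹ ss next-untouched _ (involutive IH (next s))

  τ-fixes-A : ∀ {q} → q ≢ pos s → q ≢ next s → τ (A q) ≡ A q
  τ-fixes-A {q} q≢pos q≢next = fixes ex (A q)
    (q≢pos ∘ applySwaps-untouched⁻¹ ss pos-untouched q)
    (q≢next ∘ applySwaps-untouched⁻¹ ss next-untouched q)

  involutive′ : ∀ q → τ (A (τ (A q))) ≡ q
  involutive′ q with exchanges-cases ex q
  ... | inj₁ (refl , _) rewrite A-fixes-pos | image-a ex | A-fixes-next = image-b ex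
  ... | inj₂ (inj₁ (refl , _)) rewrite A-fixes-next | image-b ex | A-fixes-pos = image-a ex
  ... | inj₂ (inj₂ (q≢pos , q≢next , τq)) rewrite τ-fixes-A q≢pos q≢next | involutive IH q = τq

  moves≤1 : ∀ q → toℕ (τ (A q)) ≤ suc (toℕ q) × toℕ q ≤ suc (toℕ (τ (A q)))
  moves≤1 q with exchanges-cases ex q
  ... | inj₁ (refl , _) rewrite A-fixes-pos | image-a ex | isNext s =
    NP.≤-refl , NP.m≤n⇒m≤1+n (NP.n≤1+n _)
  ... | inj₂ (inj₁ (refl , _)) rewrite A-fixes-next | image-b ex | isNext s =
    NP.m≤n⇒m≤1+n (NP.n≤1+n _) , NP.≤-refl
  ... | inj₂ (inj₂ (q≢pos , q≢next , _)) rewrite τ-fixes-A q≢pos q≢next =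
    moves≤1ʳ IH q , moves≤1ˡ IH q

applySwaps-++ : ∀ (xs ys : List (Swap n)) q → applySwaps (xs ++ ys) q ≡ applySwaps xs (applySwaps ys q)
applySwaps-++ []       ys q = refl
applySwaps-++ (x ∷ xs) ys q = cong (swapping x) (applySwaps-++ xs ys q)

swapping-applySwaps-comm : ∀ (s : Swap n) ss → All (λ s′ → Apart s′ s) ss →
                           ∀ k → swapping s (applySwaps ss k) ≡ applySwaps ss (swapping s k)
swapping-applySwaps-comm s []        _               k = refl
swapping-applySwaps-comm s (s′ ∷ ss) (apart ∷ apart*) k = begin
  swapping s (swapping s′ (applySwaps ss k))   ≡⟨ comm (applySwaps ss k) ⟨
  swapping s′ (swapping s (applySwaps ss k))   ≡⟨ cong (swapping s′) (swapping-applySwaps-comm s ss apart* k) ⟩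
  swapping s′ (applySwaps ss (swapping s k))   ∎
  where
  open ≡-Reasoning
  comm = exchanges-comm (swapping-exchanges s′) (swapping-exchanges s)
           (proj₁ (apart⇒pos-untouched s′ s apart)) (proj₂ (apart⇒pos-untouched s′ s apart))
           (proj₁ (apart⇒next-untouched s′ s apart)) (proj₂ (apart⇒next-untouched s′ s apart))

record SwapDecomposition (ss : List (Swap n)) (p : Fin n) : Set where
  field
    before       : List (Swap n)
    swap         : Swap n
    after        : List (Swap n)
    split        : ss ≡ before ++ swap ∷ after
    swap-pos     : pos swap ≡ p
    apart-before : All (λ s′ → Apart s′ swap) before
    apart-rest   : AllPairs Apart (before ++ after)

decompose-moved : ∀ (ss : List (Swap n)) → AllPairs Apart ss → ∀ {p p′} → toℕ p′ ≡ suc (toℕ p) →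
                  applySwaps ss p ≡ p′ → SwapDecomposition ss p
decompose-moved []       _                   p′≡1+p p↦p′ = contradiction (trans (sym p′≡1+p) (cong toℕ (sym p↦p′))) (NP.1+n≢n)
decompose-moved (s ∷ ss) (apart ∷ apart*) {p} {p′} p′≡1+p p↦p′ with pos s FP.≟ p
... | yes pos≡p = record
  { before = [] ; swap = s ; after = ss ; split = refl ; swap-pos = pos≡p ; apart-before = [] ; apart-rest = apart* }
... | no pos≢p with exchanges-cases (swapping-exchanges s) (applySwaps ss p)
...   | inj₁ (_ , τ≡next) = contradiction pos≡p pos≢p
  where
  pos≡p : pos s ≡ p
  pos≡p = FP.toℕ-injective (NP.suc-injective (begin
    suc (toℕ (pos s)) ≡⟨ isNext s ⟨
    toℕ (next s)      ≡⟨ cong toℕ (trans (sym τ≡next) p↦p′) ⟩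
    toℕ p′            ≡⟨ p′≡1+p ⟩
    suc (toℕ p)       ∎))
    where open ≡-Reasoning
...   | inj₂ (inj₁ (Ap≡next , τ≡pos)) = contradiction (begin
    toℕ (pos s)              ≡⟨ cong toℕ (trans (sym τ≡pos) p↦p′) ⟩
    toℕ p′                   ≡⟨ p′≡1+p ⟩
    suc (toℕ p)              ≡⟨ cong (suc ∘ toℕ) p≡next ⟩
    suc (toℕ (next s))       ≡⟨ cong suc (isNext s) ⟩
    suc (suc (toℕ (pos s)))  ∎) (NP.m≢1+n+m (toℕ (pos s)) {1})
  where
  open ≡-Reasoning
  p≡next : p ≡ next s
  p≡next = applySwaps-untouched⁻¹ ss (All.map (λ {s′} → apart⇒next-untouched s s′) apart) p Ap≡next
...   | inj₂ (inj₂ (_ , _ , τ≡id)) = record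
  { before = s ∷ before ; swap = swap ; after = after ; split = cong (s ∷_) split ; swap-pos = swap-pos
  ; apart-before = All.head (proj₂ apart-parts) ∷ apart-before
  ; apart-rest = AllP.++⁺ (proj₁ apart-parts) (All.tail (proj₂ apart-parts)) ∷ apart-rest }
  where
  open SwapDecomposition (decompose-moved ss apart* p′≡1+p (trans (sym τ≡id) p↦p′))
  apart-parts = AllP.++⁻ before (subst (All (Apart s)) split apart)

exchanges-conjugate : ∀ (π : Perm n) {τ : Fin n → Fin n} {a b p p′} → π ⟨$⟩ʳ p ≡ a → π ⟨$⟩ʳ p′ ≡ b →
                      Exchanges τ a b → ∀ w → τ (π ⟨$⟩ʳ w) ≡ π ⟨$⟩ʳ transpose p p′ w
exchanges-conjugate π {τ} {p = p} {p′} πp πp′ ex w with exchanges-cases (transpose-exchanges p p′) w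
... | inj₁ (refl , tw) = trans (cong τ πp) (trans (image-a ex) (trans (sym πp′) (cong (π ⟨$⟩ʳ_) (sym tw))))
... | inj₂ (inj₁ (refl , tw)) = trans (cong τ πp′) (trans (image-b ex) (trans (sym πp) (cong (π ⟨$⟩ʳ_) (sym tw))))
... | inj₂ (inj₂ (w≢p , w≢p′ , tw)) = trans
  (fixes ex (π ⟨$⟩ʳ w) (w≢p ∘ ⟨$⟩ʳ-injective π ∘ flip trans (sym πp))
                       (w≢p′ ∘ ⟨$⟩ʳ-injective π ∘ flip trans (sym πp′)))
  (cong (π ⟨$⟩ʳ_) (sym tw))

obtained-sym : ∀ {π ρ : Perm n} → ObtainedBySwaps π ρ → ObtainedBySwaps ρ π
obtained-sym {π = π} (ss , apart , ρ≗π∘A) = ss , apart , λ q →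
  trans (cong (π ⟨$⟩ʳ_) (sym (involutive (applySwaps-isLocalInvolution ss apart) q))) (sym (ρ≗π∘A _))

adjacent⇒obtained : ∀ {π ρ : Perm n} → Adjacent π ρ → ObtainedBySwaps π ρ
adjacent⇒obtained (inj₁ obtained) = obtained
adjacent⇒obtained {π = π} {ρ} (inj₂ obtained) = obtained-sym {π = ρ} {π} obtained

obtained-relabel : ∀ {π ρ π′ ρ′ : Perm n} (f : Fin n → Fin n) →
                   (∀ q → π′ ⟨$⟩ʳ q ≡ f (π ⟨$⟩ʳ q)) → (∀ q → ρ′ ⟨$⟩ʳ q ≡ f (ρ ⟨$⟩ʳ q)) →
                   ObtainedBySwaps π ρ → ObtainedBySwaps π′ ρ′
obtained-relabel f π′≗fπ ρ′≗fρ (ss , apart , ρ≗π∘A) =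
  ss , apart , λ q → trans (ρ′≗fρ q) (trans (cong f (ρ≗π∘A q)) (sym (π′≗fπ _)))

record Crossing (π ρ : Perm n) (u v : Fin n) : Set where
  field
    left right   : Fin n
    right≡1+left : toℕ right ≡ suc (toℕ left)
    π-left       : π ⟨$⟩ʳ left ≡ u
    π-right      : π ⟨$⟩ʳ right ≡ v
    ρ-left       : ρ ⟨$⟩ʳ left ≡ v
    ρ-right      : ρ ⟨$⟩ʳ right ≡ u

  left≢right : left ≢ right
  left≢right e = NP.1+n≢n (trans (sym right≡1+left) (cong toℕ (sym e)))

crossing-flip : ∀ {π ρ : Perm n} {u v} → Crossing π ρ u v → Crossing ρ π v u
crossing-flip c = record { Crossing c ; π-left = ρ-left ; π-right = ρ-right ; ρ-left = π-left ; ρ-right = π-right }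
  where open Crossing c

crossing-distinct : ∀ {π ρ : Perm n} {u v} → Crossing π ρ u v → u ≢ v
crossing-distinct {π = π} c u≡v = left≢right (⟨$⟩ʳ-injective π (trans π-left (trans u≡v (sym π-right))))
  where open Crossing c

-- σ is obtained from π by the swaps producing ρ, except the one that exchanges u and v.
remove-crossing : ∀ {π ρ σ : Perm n} {τ : Fin n → Fin n} {u v} →
                  ObtainedBySwaps π ρ → Crossing π ρ u v → Exchanges τ u v →
                  (∀ q → σ ⟨$⟩ʳ q ≡ τ (ρ ⟨$⟩ʳ q)) → ObtainedBySwaps π σ
remove-crossing {π = π} {ρ} {σ} {τ} {u} {v} (ss , apart , ρ≗π∘A) c ex σ≗τρ =
  before ++ after , apart-rest , λ q → begin
    σ ⟨$⟩ʳ q                                          ≡⟨ σ≗τρ q ⟩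
    τ (ρ ⟨$⟩ʳ q)                                      ≡⟨ cong τ (ρ≗π∘A q) ⟩
    τ (π ⟨$⟩ʳ applySwaps ss q)                        ≡⟨ cong (λ ts → τ (π ⟨$⟩ʳ applySwaps ts q)) split ⟩
    τ (π ⟨$⟩ʳ applySwaps (before ++ swap ∷ after) q)  ≡⟨ cong (τ ∘ (π ⟨$⟩ʳ_)) (applySwaps-++ before (swap ∷ after) q) ⟩
    τ (π ⟨$⟩ʳ B (S (A q)))                            ≡⟨ exchanges-conjugate π π-pos π-next ex _ ⟩
    π ⟨$⟩ʳ S (B (S (A q)))                            ≡⟨ cong (π ⟨$⟩ʳ_) (swapping-applySwaps-comm swap before apart-before _) ⟩
    π ⟨$⟩ʳ B (S (S (A q)))                            ≡⟨ cong ((π ⟨$⟩ʳ_) ∘ B) (exchanges-involutive (swapping-exchanges swap) _) ⟩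
    π ⟨$⟩ʳ B (A q)                                    ≡⟨ cong (π ⟨$⟩ʳ_) (applySwaps-++ before after q) ⟨
    π ⟨$⟩ʳ applySwaps (before ++ after) q             ∎
  where
  open ≡-Reasoning
  open Crossing c
  left↦right : applySwaps ss left ≡ right
  left↦right = ⟨$⟩ʳ-injective π (trans (sym (ρ≗π∘A left)) (trans ρ-left (sym π-right)))
  open SwapDecomposition (decompose-moved ss apart right≡1+left left↦right)
  A = applySwaps after
  B = applySwaps before
  S = swapping swap
  π-pos : π ⟨$⟩ʳ pos swap ≡ u
  π-pos = trans (cong (π ⟨$⟩ʳ_) swap-pos) π-left
  π-next : π ⟨$⟩ʳ next swap ≡ v
  π-next = trans (cong (π ⟨$⟩ʳ_) (FP.toℕ-injective (begin
    toℕ (next swap)       ≡⟨ isNext swap ⟩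
    suc (toℕ (pos swap))  ≡⟨ cong (suc ∘ toℕ) swap-pos ⟩
    suc (toℕ left)        ≡⟨ right≡1+left ⟨
    toℕ right             ∎))) π-right

length-filter-≤ : ∀ {A : Set} {P Q : A → Set} (P? : Decidable P) (Q? : Decidable Q) →
                  (∀ {x} → P x → Q x) → ∀ xs → length (filter P? xs) ≤ length (filter Q? xs)
length-filter-≤ P? Q? P⇒Q []       = z≤n
length-filter-≤ P? Q? P⇒Q (x ∷ xs) with P? x | Q? x
... | yes _  | yes _  = s≤s (length-filter-≤ P? Q? P⇒Q xs)
... | yes px | no ¬qx = contradiction (P⇒Q px) ¬qx
... | no _   | yes _  = NP.m≤n⇒m≤1+n (length-filter-≤ P? Q? P⇒Q xs)
... | no _   | no _   = length-filter-≤ P? Q? P⇒Q xs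

length-filter-< : ∀ {A : Set} {P Q : A → Set} (P? : Decidable P) (Q? : Decidable Q) →
                  (∀ {x} → P x → Q x) → ∀ {xs y} → y ∈ xs → Q y → ¬ P y →
                  length (filter P? xs) < length (filter Q? xs)
length-filter-< P? Q? P⇒Q {x ∷ xs} (here refl) qx ¬px with P? x | Q? x
... | yes px | _      = contradiction px ¬px
... | no _   | yes _  = s≤s (length-filter-≤ P? Q? P⇒Q xs)
... | no _   | no ¬qx = contradiction qx ¬qx
length-filter-< P? Q? P⇒Q {x ∷ xs} (there y∈xs) qy ¬py with P? x | Q? x
... | yes _  | yes _  = s≤s (length-filter-< P? Q? P⇒Q y∈xs qy ¬py)
... | yes px | no ¬qx = contradiction (P⇒Q px) ¬qx
... | no _   | yes _  = NP.m≤n⇒m≤1+n (length-filter-< P? Q? P⇒Q y∈xs qy ¬py)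
... | no _   | no _   = length-filter-< P? Q? P⇒Q y∈xs qy ¬py

sum-map-≤ : ∀ {A : Set} (f g : A → ℕ) xs → (∀ {x} → x ∈ xs → f x ≤ g x) → sum (map f xs) ≤ sum (map g xs)
sum-map-≤ f g []       f≤g = z≤n
sum-map-≤ f g (x ∷ xs) f≤g = NP.+-mono-≤ (f≤g (here refl)) (sum-map-≤ f g xs (f≤g ∘ there))

sum-map-< : ∀ {A : Set} (f g : A → ℕ) {xs y} → (∀ {x} → x ∈ xs → f x ≤ g x) → y ∈ xs → f y < g y →
            sum (map f xs) < sum (map g xs)
sum-map-< f g {x ∷ xs} f≤g (here refl) fx<gx = NP.+-mono-<-≤ fx<gx (sum-map-≤ f g xs (f≤g ∘ there))
sum-map-< f g {x ∷ xs} f≤g (there y∈xs) fy<gy = NP.+-mono-≤-< (f≤g (here refl)) (sum-map-< f g (f≤g ∘ there) y∈xs fy<gy)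

-- The predicate filtered by crossingsAt.
SwappedPair : Perm n → Perm n → Fin n × Fin n → Set
SwappedPair π ρ pq = toℕ (proj₂ pq) ≡ suc (toℕ (proj₁ pq))
                   × π ⟨$⟩ʳ proj₁ pq ≡ ρ ⟨$⟩ʳ proj₂ pq × π ⟨$⟩ʳ proj₂ pq ≡ ρ ⟨$⟩ʳ proj₁ pq

SwappedAt : Tangle n → ℕ → Fin n × Fin n → Set
SwappedAt T t = SwappedPair (perm T t) (perm T (suc t))

module _ (T T′ : Tangle n) (t : ℕ) (T′⊆T : ∀ {pq} → SwappedAt T′ t pq → SwappedAt T t pq) where

  crossingsAt-≤ : crossingsAt T′ t ≤ crossingsAt T t
  crossingsAt-≤ = length-filter-≤ _ _ T′⊆T (cartesianProduct (allFin n) (allFin n))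

  crossingsAt-< : ∀ pq → SwappedAt T t pq → ¬ SwappedAt T′ t pq → crossingsAt T′ t < crossingsAt T t
  crossingsAt-< (p , q) = length-filter-< _ _ T′⊆T (∈-cartesianProduct⁺ (∈-allFin p) (∈-allFin q))

CrossAt : Tangle n → ℕ → Fin n → Fin n → Set
CrossAt T t = Crossing (perm T t) (perm T (suc t))

MeetAt : Tangle n → ℕ → Fin n → Fin n → Set
MeetAt T t u v = CrossAt T t u v ⊎ CrossAt T t v u

crossing-changes : ∀ {π ρ : Perm n} {a b} → Crossing π ρ a b → ¬ (π ≐ ρ)
crossing-changes c π≐ρ = crossing-distinct c (trans (sym π-left) (trans (π≐ρ left) ρ-left))
  where open Crossing c

record OrientedMeet (π ρ : Perm n) (u v : Fin n) : Set where
  field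
    first second : Fin n
    crossing     : Crossing π ρ first second
    exchanges    : Exchanges (transpose u v) first second

meet-orient : ∀ {π ρ : Perm n} {u v} → Crossing π ρ u v ⊎ Crossing π ρ v u → OrientedMeet π ρ u v
meet-orient {u = u} {v} (inj₁ c) = record { crossing = c ; exchanges = transpose-exchanges u v }
meet-orient {u = u} {v} (inj₂ c) = record { crossing = c ; exchanges = exchanges-sym (transpose-exchanges u v) }

module _ {π ρ : Perm n} {τ : Fin n → Fin n} {a b} (c : Crossing π ρ a b) (ex : Exchanges τ a b) where
  open Crossing c

  -- If ρ r′ is a or b then π r is the other one, which forces r = r′.
  crossing-relabel⁻¹ : ∀ {r r′} → r ≢ r′ → π ⟨$⟩ʳ r ≡ τ (ρ ⟨$⟩ʳ r′) → π ⟨$⟩ʳ r ≡ ρ ⟨$⟩ʳ r′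
  crossing-relabel⁻¹ {r} {r′} r≢r′ πr≡τρr′ with exchanges-cases ex (ρ ⟨$⟩ʳ r′)
  ... | inj₁ (ρr′≡a , τ≡b) = contradiction
    (trans (⟨$⟩ʳ-injective π (trans πr≡τρr′ (trans τ≡b (sym π-right))))
           (sym (⟨$⟩ʳ-injective ρ (trans ρr′≡a (sym ρ-right))))) r≢r′
  ... | inj₂ (inj₁ (ρr′≡b , τ≡a)) = contradiction
    (trans (⟨$⟩ʳ-injective π (trans πr≡τρr′ (trans τ≡a (sym π-left))))
           (sym (⟨$⟩ʳ-injective ρ (trans ρr′≡b (sym ρ-left))))) r≢r′
  ... | inj₂ (inj₂ (_ , _ , τ≡id)) = trans πr≡τρr′ τ≡id

  crossing-swappedPair-relabel⁻¹ : ∀ {ρ′ : Perm n} → (∀ q → ρ′ ⟨$⟩ʳ q ≡ τ (ρ ⟨$⟩ʳ q)) →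
                          ∀ {pq} → SwappedPair π ρ′ pq → SwappedPair π ρ pq
  crossing-swappedPair-relabel⁻¹ ρ′≗τρ {r , r′} (r′≡1+r , πr≡ρ′r′ , πr′≡ρ′r) =
      r′≡1+r
    , crossing-relabel⁻¹ r≢r′ (trans πr≡ρ′r′ (ρ′≗τρ r′))
    , crossing-relabel⁻¹ (r≢r′ ∘ sym) (trans πr′≡ρ′r (ρ′≗τρ r))
    where
    r≢r′ : r ≢ r′
    r≢r′ e = NP.1+n≢n (trans (sym r′≡1+r) (cong toℕ (sym e)))

crossing⇒swappedPair : ∀ {π ρ : Perm n} {a b} (c : Crossing π ρ a b) →
                       SwappedPair π ρ (Crossing.left c , Crossing.right c)
crossing⇒swappedPair c = right≡1+left , trans π-left (sym ρ-right) , trans π-right (sym ρ-left)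
  where open Crossing c

swappedPair-sym : ∀ {π ρ : Perm n} {pq} → SwappedPair π ρ pq → SwappedPair ρ π pq
swappedPair-sym (q≡1+p , πp≡ρq , πq≡ρp) = q≡1+p , sym πq≡ρp , sym πp≡ρq

swappedPair-relabel⁻¹ : ∀ {π ρ π′ ρ′ : Perm n} (f : Fin n → Fin n) → (∀ {x y} → f x ≡ f y → x ≡ y) →
                        (∀ q → π′ ⟨$⟩ʳ q ≡ f (π ⟨$⟩ʳ q)) → (∀ q → ρ′ ⟨$⟩ʳ q ≡ f (ρ ⟨$⟩ʳ q)) →
                        ∀ {pq} → SwappedPair π′ ρ′ pq → SwappedPair π ρ pq
swappedPair-relabel⁻¹ f f-injective π′≗fπ ρ′≗fρ {p , q} (q≡1+p , π′p≡ρ′q , π′q≡ρ′p) =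
    q≡1+p
  , f-injective (trans (sym (π′≗fπ p)) (trans π′p≡ρ′q (ρ′≗fρ q)))
  , f-injective (trans (sym (π′≗fπ q)) (trans π′q≡ρ′p (ρ′≗fρ p)))

-- Relabelling u ↔ v on (t₁, t₂] drops the swaps of u and v at t₁ and at t₂ and creates none.
module Uncross (T : Tangle n) {u v : Fin n} {t₁ t₂ : ℕ} (t₁<t₂ : t₁ < t₂) (t₂<len : t₂ < len T)
               (meet₁ : MeetAt T t₁ u v) (meet₂ : MeetAt T t₂ u v) where

  τ : Fin n → Fin n
  τ = transpose u v

  Between : ℕ → Set
  Between t = t₁ < t × t ≤ t₂

  between? : ∀ t → Dec (Between t)
  between? t = (t₁ <? t) ×-dec (t ≤? t₂)

  perm′ : ℕ → Perm n
  perm′ t with between? t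
  ... | yes _ = perm T t ∘ₚ PF.transpose u v
  ... | no _  = perm T t

  perm′-between : ∀ {t} → Between t → ∀ q → perm′ t ⟨$⟩ʳ q ≡ τ (perm T t ⟨$⟩ʳ q)
  perm′-between {t} b q with between? t
  ... | yes _ = refl
  ... | no ¬b = contradiction b ¬b

  perm′-outside : ∀ {t} → ¬ Between t → perm′ t ≐ perm T t
  perm′-outside {t} ¬b q with between? t
  ... | yes b = contradiction b ¬b
  ... | no _  = refl

  entering : ∀ {t} → ¬ Between t → Between (suc t) → t ≡ t₁
  entering {t} ¬b (t₁<1+t , 1+t≤t₂) with t₁ <? t
  ... | yes t₁<t = contradiction (t₁<t , NP.<⇒≤ 1+t≤t₂) ¬b
  ... | no t₁≮t  = NP.≤-antisym (NP.≮⇒≥ t₁≮t) (NP.≤-pred t₁<1+t)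

  leaving : ∀ {t} → Between t → ¬ Between (suc t) → t ≡ t₂
  leaving {t} (t₁<t , t≤t₂) ¬b′ with suc t ≤? t₂
  ... | yes 1+t≤t₂ = contradiction (NP.m≤n⇒m≤1+n t₁<t , 1+t≤t₂) ¬b′
  ... | no 1+t≰t₂  = NP.≤-antisym t≤t₂ (NP.≤-pred (NP.≰⇒> 1+t≰t₂))

  module M₁ = OrientedMeet (meet-orient meet₁)
  module M₂ = OrientedMeet (meet-orient meet₂)

  obtained : ∀ t → t < len T → ObtainedBySwaps (perm T t) (perm T (suc t))
  obtained t t<len = adjacent⇒obtained {π = perm T t} {perm T (suc t)} (adjacent T t t<len)

  obtained′ : ∀ t → t < len T → Dec (Between t) → Dec (Between (suc t)) → ObtainedBySwaps (perm′ t) (perm′ (suc t))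
  obtained′ t t<len (no ¬b) (no ¬b′) =
    obtained-relabel {π = perm T t} {perm T (suc t)} {perm′ t} {perm′ (suc t)}
      id (perm′-outside ¬b) (perm′-outside ¬b′) (obtained t t<len)
  obtained′ t t<len (yes b) (yes b′) =
    obtained-relabel {π = perm T t} {perm T (suc t)} {perm′ t} {perm′ (suc t)}
      τ (perm′-between b) (perm′-between b′) (obtained t t<len)
  obtained′ t t<len (no ¬b) (yes b′) with entering ¬b b′
  ... | refl = obtained-relabel {π = perm T t} {perm′ (suc t)} {perm′ t} {perm′ (suc t)}
                 id (perm′-outside ¬b) (λ _ → refl)
                 (remove-crossing {π = perm T t} {perm T (suc t)} {perm′ (suc t)}
                    (obtained t t<len) M₁.crossing M₁.exchanges (perm′-between b′))
  obtained′ t t<len (yes b) (no ¬b′) with leaving b ¬b′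
  ... | refl = obtained-sym {π = perm′ (suc t)} {perm′ t}
                 (obtained-relabel {π = perm T (suc t)} {perm′ t} {perm′ (suc t)} {perm′ t}
                    id (perm′-outside ¬b′) (λ _ → refl)
                    (remove-crossing {π = perm T (suc t)} {perm T t} {perm′ t}
                       (obtained-sym {π = perm T t} {perm T (suc t)} (obtained t t<len))
                       (crossing-flip M₂.crossing) (exchanges-sym M₂.exchanges) (perm′-between b)))

  T′ : Tangle n
  T′ = record { len = len T ; perm = perm′
              ; adjacent = λ t t<len → inj₁ (obtained′ t t<len (between? t) (between? (suc t))) }

  swapped′⇒swapped : ∀ t → Dec (Between t) → Dec (Between (suc t)) → ∀ {pq} → SwappedAt T′ t pq → SwappedAt T t pq
  swapped′⇒swapped t (no ¬b) (no ¬b′) =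
    swappedPair-relabel⁻¹ {π = perm T t} {perm T (suc t)} {perm′ t} {perm′ (suc t)} id id (perm′-outside ¬b) (perm′-outside ¬b′)
  swapped′⇒swapped t (yes b) (yes b′) =
    swappedPair-relabel⁻¹ {π = perm T t} {perm T (suc t)} {perm′ t} {perm′ (suc t)} τ (exchanges-injective (transpose-exchanges u v))
      (perm′-between b) (perm′-between b′)
  swapped′⇒swapped t (no ¬b) (yes b′) with entering ¬b b′
  ... | refl = crossing-swappedPair-relabel⁻¹ M₁.crossing M₁.exchanges {perm′ (suc t)} (perm′-between b′)
             ∘ swappedPair-relabel⁻¹ {π = perm T t} {perm′ (suc t)} {perm′ t} {perm′ (suc t)} id id (perm′-outside ¬b) (λ _ → refl)
  swapped′⇒swapped t (yes b) (no ¬b′) with leaving b ¬b′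
  ... | refl = swappedPair-sym {π = perm T (suc t)} {perm T t}
             ∘ crossing-swappedPair-relabel⁻¹ (crossing-flip M₂.crossing) (exchanges-sym M₂.exchanges) {perm′ t} (perm′-between b)
             ∘ swappedPair-relabel⁻¹ {π = perm T (suc t)} {perm′ t} {perm′ (suc t)} {perm′ t} id id (perm′-outside ¬b′) (λ _ → refl)
             ∘ swappedPair-sym {π = perm′ t} {perm′ (suc t)}

  fewer-crossings : crossings T′ < crossings T
  fewer-crossings = sum-map-< (crossingsAt T′) (crossingsAt T)
    (λ {t} _ → crossingsAt-≤ T T′ t (swapped′⇒swapped t (between? t) (between? (suc t))))
    (∈-upTo⁺ (NP.<-trans t₁<t₂ t₂<len))
    (crossingsAt-< T T′ t₁ (swapped′⇒swapped t₁ (between? t₁) (between? (suc t₁)))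
       (left , right) (crossing⇒swappedPair M₁.crossing) removed)
    where
    open Crossing M₁.crossing
    removed : ¬ SwappedAt T′ t₁ (left , right)
    removed (_ , left↦right , _) = crossing-distinct M₁.crossing (begin
      M₁.first                         ≡⟨ π-left ⟨
      perm T t₁ ⟨$⟩ʳ left               ≡⟨ perm′-outside (λ (t₁<t₁ , _) → NP.<-irrefl refl t₁<t₁) left ⟨
      perm′ t₁ ⟨$⟩ʳ left                ≡⟨ left↦right ⟩
      perm′ (suc t₁) ⟨$⟩ʳ right         ≡⟨ perm′-between (NP.n<1+n t₁ , t₁<t₂) right ⟩
      τ (perm T (suc t₁) ⟨$⟩ʳ right)    ≡⟨ cong τ ρ-right ⟩
      τ M₁.first                       ≡⟨ image-a M₁.exchanges ⟩
      M₁.second                        ∎)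
      where open ≡-Reasoning

  module _ {π : Perm n} (sol : Solves T π) where
    private
      π≐perm₀ = proj₁ sol
      end-id   = proj₁ (proj₂ sol)
      1≤len    = proj₁ (proj₂ (proj₂ sol))
      idle₀    = proj₁ (proj₂ (proj₂ (proj₂ sol)))
      idle-end = proj₂ (proj₂ (proj₂ (proj₂ sol)))

      late : ∀ {t} → t₂ < t → ¬ Between t
      late t₂<t (_ , t≤t₂) = NP.<⇒≱ t₂<t t≤t₂

      -- The conventions π₀ = π₁ and π_{m-1} = π_m keep both meetings away from the ends.
      1≤t₁ : 1 ≤ t₁
      1≤t₁ = NP.n≢0⇒n>0 λ t₁≡0 → crossing-changes M₁.crossing
        (subst (λ t → perm T t ≐ perm T (suc t)) (sym t₁≡0) idle₀)

      t₂<len∸1 : t₂ < len T ∸ 1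
      t₂<len∸1 with NP.m≤n⇒m<n∨m≡n t₂<len
      ... | inj₁ 1+t₂<len = NP.∸-monoˡ-≤ 1 1+t₂<len
      ... | inj₂ refl     = contradiction idle-end (crossing-changes M₂.crossing)

    solves′ : Solves T′ π
    solves′ = (λ q → trans (perm′-outside (λ ()) q) (π≐perm₀ q))
            , (λ q → trans (perm′-outside (late t₂<len) q) (end-id q))
            , 1≤len
            , (λ q → trans (perm′-outside (λ ()) q)
                      (trans (idle₀ q) (sym (perm′-outside (λ (t₁<1 , _) → NP.<⇒≱ t₁<1 1≤t₁) q))))
            , (λ q → trans (perm′-outside (late t₂<len∸1) q)
                      (trans (idle-end q) (sym (perm′-outside (late t₂<len) q))))

simple⇒meets-once : ∀ (T : Tangle n) (π : Perm n) → SimpleSolving T π → ∀ {u v t t′} →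
                    t < len T → t′ < len T → MeetAt T t u v → MeetAt T t′ u v → t ≡ t′
simple⇒meets-once T π (solves , minimal) {u} {v} {t} {t′} t<len t′<len meet meet′ with NP.<-cmp t t′
... | tri≈ _ t≡t′ _ = t≡t′
... | tri< t<t′ _ _ = contradiction (minimal T′ (solves′ {π} solves)) (NP.<⇒≱ fewer-crossings)
  where open Uncross T {u} {v} t<t′ t′<len meet meet′
... | tri> _ _ t′<t = contradiction (minimal T′ (solves′ {π} solves)) (NP.<⇒≱ fewer-crossings)
  where open Uncross T {u} {v} t′<t t<len meet′ meet

record LocalStep (π ρ : Perm n) : Set where
  field
    shift             : Fin n → Fin n
    isLocalInvolution : IsLocalInvolution shift
    ρ≗π∘shift         : ∀ q → ρ ⟨$⟩ʳ q ≡ π ⟨$⟩ʳ shift q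

  ⟨$⟩ˡ-shift : ∀ x → ρ ⟨$⟩ˡ x ≡ shift (π ⟨$⟩ˡ x)
  ⟨$⟩ˡ-shift x = ⟨$⟩ˡ-from-⟨$⟩ʳ ρ (begin
    ρ ⟨$⟩ʳ shift (π ⟨$⟩ˡ x)          ≡⟨ ρ≗π∘shift _ ⟩
    π ⟨$⟩ʳ shift (shift (π ⟨$⟩ˡ x))  ≡⟨ cong (π ⟨$⟩ʳ_) (involutive isLocalInvolution _) ⟩
    π ⟨$⟩ʳ (π ⟨$⟩ˡ x)                ≡⟨ inverseʳ π ⟩
    x                                ∎)
    where open ≡-Reasoning

  order-reversal : ∀ {i j} → toℕ i < toℕ j → toℕ (shift j) < toℕ (shift i) → Crossing π ρ (π ⟨$⟩ʳ i) (π ⟨$⟩ʳ j)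
  order-reversal {i} {j} i<j Aj<Ai = record
    { left = i ; right = j ; right≡1+left = j≡1+i ; π-left = refl ; π-right = refl
    ; ρ-left = trans (ρ≗π∘shift i) (cong (π ⟨$⟩ʳ_) Ai≡j)
    ; ρ-right = trans (ρ≗π∘shift j) (cong (π ⟨$⟩ʳ_) (trans (cong shift (sym Ai≡j)) (involutive isLocalInvolution i))) }
    where
    open NP.≤-Reasoning
    j≤1+i : toℕ j ≤ suc (toℕ i)
    j≤1+i = begin
      toℕ j              ≤⟨ moves≤1ˡ isLocalInvolution j ⟩
      suc (toℕ (shift j)) ≤⟨ Aj<Ai ⟩
      toℕ (shift i)      ≤⟨ moves≤1ʳ isLocalInvolution i ⟩
      suc (toℕ i)        ∎
    j≡1+i : toℕ j ≡ suc (toℕ i)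
    j≡1+i = NP.≤-antisym j≤1+i i<j
    Ai≡j : shift i ≡ j
    Ai≡j = FP.toℕ-injective (NP.≤-antisym
      (NP.≤-trans (moves≤1ʳ isLocalInvolution i) (NP.≤-reflexive (sym j≡1+i)))
      (NP.≤-trans (moves≤1ˡ isLocalInvolution j) Aj<Ai))

obtained⇒localStep : ∀ {π ρ : Perm n} → ObtainedBySwaps π ρ → LocalStep π ρ
obtained⇒localStep (ss , apart , ρ≗π∘A) = record
  { shift = applySwaps ss ; isLocalInvolution = applySwaps-isLocalInvolution ss apart ; ρ≗π∘shift = ρ≗π∘A }

LeftOf : Tangle n → ℕ → Fin n → Fin n → Set
LeftOf T t u v = position T u t < position T v t

position-injective : ∀ (T : Tangle n) t {u v} → position T u t ≡ position T v t → u ≡ v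
position-injective T t {u} {v} e = begin
  u                              ≡⟨ inverseʳ (perm T t) ⟨
  perm T t ⟨$⟩ʳ (perm T t ⟨$⟩ˡ u)  ≡⟨ cong (perm T t ⟨$⟩ʳ_) (FP.toℕ-injective e) ⟩
  perm T t ⟨$⟩ʳ (perm T t ⟨$⟩ˡ v)  ≡⟨ inverseʳ (perm T t) ⟩
  v                              ∎
  where open ≡-Reasoning

module _ (T : Tangle n) {t : ℕ} (t<len : t < len T) where
  open LocalStep (obtained⇒localStep {π = perm T t} {perm T (suc t)} (adjacent⇒obtained {π = perm T t} {perm T (suc t)} (adjacent T t t<len)))

  overtaking⇒crossing : ∀ {u v} → LeftOf T t v u → LeftOf T (suc t) u v → CrossAt T t v u
  overtaking⇒crossing {u} {v} v<u u<v = subst₂ (CrossAt T t) (inverseʳ (perm T t)) (inverseʳ (perm T t))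
    (order-reversal v<u (subst₂ (λ i j → toℕ i < toℕ j) (⟨$⟩ˡ-shift u) (⟨$⟩ˡ-shift v) u<v))

  moving-left⇒crossing : ∀ {x} → position T x (suc t) < position T x t → Σ (Fin n) λ y → CrossAt T t y x
  moving-left⇒crossing {x} moved = perm T t ⟨$⟩ʳ shift q , subst (CrossAt T t (perm T t ⟨$⟩ʳ shift q)) (inverseʳ (perm T t))
    (order-reversal {shift q} {q} Aq<q (subst (λ k → toℕ (shift q) < toℕ k) (sym (involutive isLocalInvolution q)) Aq<q))
    where
    q = perm T t ⟨$⟩ˡ x
    Aq<q : toℕ (shift q) < toℕ q
    Aq<q = subst (λ k → toℕ k < toℕ q) (⟨$⟩ˡ-shift x) moved

  moving-right⇒crossing : ∀ {x} → position T x t < position T x (suc t) → Σ (Fin n) λ z → CrossAt T t x z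
  moving-right⇒crossing {x} moved = perm T t ⟨$⟩ʳ shift q , subst (λ w → CrossAt T t w (perm T t ⟨$⟩ʳ shift q)) (inverseʳ (perm T t))
    (order-reversal {q} {shift q} q<Aq (subst (λ k → toℕ k < toℕ (shift q)) (sym (involutive isLocalInvolution q)) q<Aq))
    where
    q = perm T t ⟨$⟩ˡ x
    q<Aq : toℕ q < toℕ (shift q)
    q<Aq = subst (λ k → toℕ q < toℕ k) (⟨$⟩ˡ-shift x) moved

descend : ∀ {P : ℕ → Set} {a} → (∀ {t} → t < a → P (suc t) → P t) → P a → P 0
descend {a = zero}  step pa = pa
descend {a = suc a} step pa = descend (step ∘ NP.m<n⇒m<1+n) (step (NP.n<1+n a) pa)

ascend : ∀ {P : ℕ → Set} {a b} → a ≤′ b → (∀ {t} → a ≤ t → t < b → P t → P (suc t)) → P a → P b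
ascend ≤′-refl            step pa = pa
ascend (≤′-step a≤′b) step pa =
  step (NP.≤′⇒≤ a≤′b) (NP.n<1+n _) (ascend a≤′b (λ a≤t t<b → step a≤t (NP.m<n⇒m<1+n t<b)) pa)

crossing⇒inversion : ∀ (T : Tangle n) (π : Perm n) → SimpleSolving T π → ∀ {a u v} →
                     a < len T → CrossAt T a u v → LeftOf T 0 u v × v Fin.< u
crossing⇒inversion T π simple {a} {u} {v} a<len c =
  descend before at-a , subst₂ _<_ (at-end v) (at-end u) (ascend (NP.≤⇒≤′ a<len) after after-a)
  where
  open Crossing c
  only-at-a : ∀ {t} → t < len T → MeetAt T t u v → t ≡ a
  only-at-a t<len m = simple⇒meets-once T π simple t<len a<len m (inj₁ c)

  at-a : LeftOf T a u v
  at-a = subst₂ (λ i j → toℕ i < toℕ j)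
    (sym (⟨$⟩ˡ-from-⟨$⟩ʳ (perm T a) π-left)) (sym (⟨$⟩ˡ-from-⟨$⟩ʳ (perm T a) π-right)) (NP.≤-reflexive (sym right≡1+left))
  after-a : LeftOf T (suc a) v u
  after-a = subst₂ (λ i j → toℕ i < toℕ j)
    (sym (⟨$⟩ˡ-from-⟨$⟩ʳ (perm T (suc a)) ρ-left)) (sym (⟨$⟩ˡ-from-⟨$⟩ʳ (perm T (suc a)) ρ-right)) (NP.≤-reflexive (sym right≡1+left))

  before : ∀ {t} → t < a → LeftOf T (suc t) u v → LeftOf T t u v
  before {t} t<a u<v′ with NP.<-cmp (position T u t) (position T v t)
  ... | tri< u<v _ _ = u<v
  ... | tri≈ _ e _   = contradiction (position-injective T t e) (crossing-distinct c)
  ... | tri> _ _ v<u = contradiction (only-at-a t<len (inj₂ (overtaking⇒crossing T t<len v<u u<v′))) (NP.<⇒≢ t<a)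
    where t<len = NP.<-trans t<a a<len

  after : ∀ {t} → suc a ≤ t → t < len T → LeftOf T t v u → LeftOf T (suc t) v u
  after {t} a<t t<len v<u with NP.<-cmp (position T v (suc t)) (position T u (suc t))
  ... | tri< v<u′ _ _ = v<u′
  ... | tri≈ _ e _    = contradiction (position-injective T (suc t) e) (crossing-distinct c ∘ sym)
  ... | tri> _ _ u<v′ = contradiction (only-at-a t<len (inj₂ (overtaking⇒crossing T t<len v<u u<v′))) (NP.>⇒≢ a<t)

  at-end : ∀ w → position T w (len T) ≡ toℕ w
  at-end w = cong toℕ (⟨$⟩ˡ-from-⟨$⟩ʳ (perm T (len T)) (proj₁ (proj₂ (proj₁ simple)) w))

i-j<0⇒i<j : ∀ {i j : ℤ} → i ℤ.- j ℤ.< + 0 → i ℤ.< j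
i-j<0⇒i<j i-j<0 = ZP.≰⇒> (λ j≤i → ZP.<⇒≱ i-j<0 (ZP.i≤j⇒0≤j-i j≤i))

0<i-j⇒j<i : ∀ {i j : ℤ} → + 0 ℤ.< i ℤ.- j → j ℤ.< i
0<i-j⇒j<i 0<i-j = ZP.≰⇒> (λ i≤j → ZP.<⇒≱ 0<i-j (ZP.i≤j⇒i-j≤0 i≤j))

segment-start<len : ∀ {T : Tangle n} {x a b} → IsSegment T x a b → a < len T
segment-start<len (a<b , b≤len , _) = NP.<-≤-trans a<b b≤len

lemma3 : (n : ℕ) (π : Perm n) → Avoids321 π →
         (T : Tangle n) → SimpleSolving T π →
         (x : Fin n) → ¬ (HasLSegment T x × HasRSegment T x)
lemma3 n π avoids T simple x ((a , _ , seg , step<0) , (a′ , _ , seg′ , 0<step)) =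
  avoids _ _ _ (proj₁ y-inversion) (proj₁ z-inversion)
    (subst₂ Fin._<_ (sym (at-start x)) (sym (at-start y)) (proj₂ y-inversion) ,
     subst₂ Fin._<_ (sym (at-start z)) (sym (at-start x)) (proj₂ z-inversion))
  where
  a<len  = segment-start<len {T = T} {x} seg
  a′<len = segment-start<len {T = T} {x} seg′
  left-meet  = moving-left⇒crossing T a<len {x} (ZP.drop‿+<+ (i-j<0⇒i<j step<0))
  right-meet = moving-right⇒crossing T a′<len {x} (ZP.drop‿+<+ (0<i-j⇒j<i 0<step))
  y = proj₁ left-meet
  z = proj₁ right-meet
  y-inversion = crossing⇒inversion T π simple a<len (proj₂ left-meet)
  z-inversion = crossing⇒inversion T π simple a′<len (proj₂ right-meet)
  at-start : ∀ w → π ⟨$⟩ʳ (perm T 0 ⟨$⟩ˡ w) ≡ w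
  at-start w = trans (sym (proj₁ (proj₁ simple) _)) (inverseʳ (perm T 0))
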